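{- Let $G$ be a connected graph and let $e,f\in E(G)$. If $S_e\neq S_f$, then $V(S_e)\neq V(S_f)$.
   Context: For $e\in E(G)$, let $\mathcal{S}_e$ be the family of all sets $S\subseteq E(G)$ such that $e\in S$ and, for every edge $d\notin S$, there is no induced copy of $P_3$ in $G$ consisting of $d$ and an edge of $S$. $S_e$ denotes the member of $\mathcal{S}_e$ of minimum cardinality (it is unique; equivalently it is the intersection of all members of $\mathcal{S}_e$). For a set of edges $E$, $V(E)$ denotes the set of endpoints of edges in $E$. -}

module Defs where

open import Data.Nat using (ℕ; _≤_)
open import Data.Fin using (Fin)
open import Data.Fin.Subset using (Subset; _∈_; _∉_; ∣_∣)
open import Data.Product using (Σ; ∃; _×_; _,_; proj₁; proj₂)
open import Data.Sum using (_⊎_)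
open import Relation.Nullary using (¬_)
open import Relation.Binary.PropositionalEquality using (_≡_; _≢_)

record Graph : Set where
  field
    n m : ℕ
    ends : Fin m → Fin n × Fin n

  Joins : Fin m → Fin n → Fin n → Set
  Joins e u v = (ends e ≡ (u , v)) ⊎ (ends e ≡ (v , u))

  Adj : Fin n → Fin n → Set
  Adj u v = ∃ λ e → Joins e u v

  field
    loopless : ∀ e → proj₁ (ends e) ≢ proj₂ (ends e)
    noParallel : ∀ e e' u v → Joins e u v → Joins e' u v → e ≡ e'

  IsEnd : Fin n → Fin m → Set
  IsEnd v e = (v ≡ proj₁ (ends e)) ⊎ (v ≡ proj₂ (ends e))

open Graph public

data Walk (G : Graph) : Fin (n G) → Fin (n G) → Set where
  [] : ∀ {u} → Walk G u u
  _∷_ : ∀ {u v w} → Adj G u v → Walk G v w → Walk G u w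

Connected : Graph → Set
Connected G = ∀ u v → Walk G u v

InducedP3 : (G : Graph) → Fin (m G) → Fin (m G) → Set
InducedP3 G d s = Σ (Fin (n G)) λ a → Σ (Fin (n G)) λ b → Σ (Fin (n G)) λ c →
  Joins G d a b × Joins G s b c × a ≢ c × ¬ Adj G a c

InFamily : (G : Graph) → Fin (m G) → Subset (m G) → Set
InFamily G e S = e ∈ S × (∀ d s → d ∉ S → s ∈ S → ¬ InducedP3 G d s)

IsSe : (G : Graph) → Fin (m G) → Subset (m G) → Set
IsSe G e S = InFamily G e S × (∀ T → InFamily G e T → ∣ S ∣ ≤ ∣ T ∣)

_∈V_ : {G : Graph} → Fin (n G) → Subset (m G) → Set
_∈V_ {G} v S = ∃ λ d → d ∈ S × IsEnd G v d

SameVertexSet : (G : Graph) → Subset (m G) → Subset (m G) → Set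
SameVertexSet G S T = ∀ v → (_∈V_ {G} v S → _∈V_ {G} v T) × (_∈V_ {G} v T → _∈V_ {G} v S)

-- Call a set of edges closed if no induced P₃ joins an edge inside it to an edge
-- outside it. Closed sets are closed under complement and intersection, so each
-- S_f is an atom of this Boolean algebra: it lies in every closed set meeting
-- it, and two distinct S_e, S_f are disjoint.
--
-- Local fact: if g = xy ∈ S_f and a vertex a is joined to x and y by edges
-- outside S_f, then a ∉ V(S_f). Indeed the edges outside S_f together with the
-- edges whose ends are both joined to a by edges outside S_f form a closed set
-- containing g, hence containing S_f; an edge of S_f at a would give a loop.
--
-- Now let e = xy ∈ S_e and let V(S_e) = V(S_f). Then x ∈ V(S_f), say by
-- g = xw ∈ S_f, so g ∉ S_e. If w, y were not adjacent, w-x-y would be an induced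
-- P₃ joining g ∉ S_e to e ∈ S_e; so some h joins w and y. If h ∉ S_e, the
-- triangle over e excludes w from V(S_e) although w ∈ V(S_f); if h ∈ S_e, then
-- h, e ∉ S_f and the triangle over g excludes y from V(S_f) although y ∈ V(S_e).
module Submission where

open import Defs
open import Data.Nat using (ℕ; _≤_)
open import Data.Nat.Properties using (<⇒≱)
open import Data.Bool.Properties using (T-≡)
open import Data.Fin using (Fin; _≟_)
open import Data.Fin.Subset using (Subset; _∈_; _∉_; _⊆_; _∩_; _∪_; ∁; ∣_∣)
open import Data.Fin.Subset.Properties
  using (_∈?_; p⊂q⇒∣p∣<∣q∣; p∩q⊆p; x∈p∩q⁺; x∈p∩q⁻; x∈p∪q⁺; x∈p∪q⁻;
         x∈∁p⇒x∉p; x∉p⇒x∈∁p; x∉∁p⇒x∈p; ⊆-antisym)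
open import Data.Fin.Properties using (any?)
open import Data.Vec.Base using (tabulate)
open import Data.Vec.Properties using (lookup∘tabulate; lookup⇒[]=; []=⇒lookup)
open import Data.Product using (∃; _×_; _,_; proj₁; proj₂)
open import Data.Product.Properties using (≡-dec)
open import Data.Sum using (_⊎_; inj₁; inj₂; swap; [_,_]′)
open import Function using (_∘_)
open import Function.Bundles using (Equivalence)
open import Relation.Nullary using (¬_; Dec; yes; no; contradiction)
open import Relation.Nullary.Decidable using (¬?; _×-dec_; _⊎-dec_; isYes; toWitness; fromWitness)
open import Relation.Unary using (Pred; Decidable)
open import Relation.Binary.PropositionalEquality using (_≢_; refl; sym; trans; cong; subst)

module _ {k : ℕ} {ℓ} {P : Pred (Fin k) ℓ} (P? : Decidable P) where

  fromDec : Subset k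
  fromDec = tabulate (isYes ∘ P?)

  ∈-fromDec⁺ : ∀ {x} → P x → x ∈ fromDec
  ∈-fromDec⁺ {x} px =
    lookup⇒[]= x fromDec
      (trans (lookup∘tabulate _ x) (Equivalence.to T-≡ (fromWitness {a? = P? x} px)))

  ∈-fromDec⁻ : ∀ {x} → x ∈ fromDec → P x
  ∈-fromDec⁻ {x} x∈ =
    toWitness (Equivalence.from T-≡ (trans (sym (lookup∘tabulate _ x)) ([]=⇒lookup x∈)))

∣p∣≤∣p∩q∣⇒p⊆q : ∀ {k} (p q : Subset k) → ∣ p ∣ ≤ ∣ p ∩ q ∣ → p ⊆ q
∣p∣≤∣p∩q∣⇒p⊆q p q le {x} x∈p with x ∈? q
... | yes x∈q = x∈q
... | no x∉q =
  contradiction le (<⇒≱ (p⊂q⇒∣p∣<∣q∣ (p∩q⊆p p q , x , x∈p , x∉q ∘ proj₂ ∘ x∈p∩q⁻ p q)))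

module _ (G : Graph) where

  Closed : Subset (m G) → Set
  Closed S = ∀ d s → d ∉ S → s ∈ S → ¬ InducedP3 G d s

  Joins-sym : ∀ {d u v} → Joins G d u v → Joins G d v u
  Joins-sym = swap

  Adj-sym : ∀ {u v} → Adj G u v → Adj G v u
  Adj-sym (d , j) = d , Joins-sym j

  InducedP3-sym : ∀ {d s} → InducedP3 G d s → InducedP3 G s d
  InducedP3-sym (a , b , c , jd , js , a≢c , a≁c) =
    c , b , a , Joins-sym js , Joins-sym jd , a≢c ∘ sym , a≁c ∘ Adj-sym

  ¬Joins-loop : ∀ {d a} → ¬ Joins G d a a
  ¬Joins-loop {d} (inj₁ eq) = loopless G d (trans (cong proj₁ eq) (sym (cong proj₂ eq)))
  ¬Joins-loop {d} (inj₂ eq) = loopless G d (trans (cong proj₁ eq) (sym (cong proj₂ eq)))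

  Joins⇒IsEnd : ∀ {d u v} → Joins G d u v → IsEnd G u d
  Joins⇒IsEnd (inj₁ eq) = inj₁ (cong proj₁ (sym eq))
  Joins⇒IsEnd (inj₂ eq) = inj₂ (cong proj₂ (sym eq))

  IsEnd⇒Joins : ∀ {v d} → IsEnd G v d → ∃ λ w → Joins G d v w
  IsEnd⇒Joins {d = d} (inj₁ refl) = proj₂ (ends G d) , inj₁ refl
  IsEnd⇒Joins {d = d} (inj₂ refl) = proj₁ (ends G d) , inj₂ refl

  joins? : ∀ d u v → Dec (Joins G d u v)
  joins? d u v = ≡-dec _≟_ _≟_ (ends G d) (u , v) ⊎-dec ≡-dec _≟_ _≟_ (ends G d) (v , u)

  adj? : ∀ u v → Dec (Adj G u v)
  adj? u v = any? (λ d → joins? d u v)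

  ∁-closed : ∀ {S} → Closed S → Closed (∁ S)
  ∁-closed cS d s d∉∁S s∈∁S = cS s d (x∈∁p⇒x∉p s∈∁S) (x∉∁p⇒x∈p d∉∁S) ∘ InducedP3-sym

  ∩-closed : ∀ {S T} → Closed S → Closed T → Closed (S ∩ T)
  ∩-closed {S} {T} cS cT d s d∉S∩T s∈S∩T with d ∈? S | x∈p∩q⁻ S T s∈S∩T
  ... | yes d∈S | _ , s∈T = cT d s (λ d∈T → d∉S∩T (x∈p∩q⁺ (d∈S , d∈T))) s∈T
  ... | no d∉S  | s∈S , _ = cS d s d∉S s∈S

  IsSe⇒⊆ : ∀ {e S T} → IsSe G e S → InFamily G e T → S ⊆ T
  IsSe⇒⊆ {S = S} {T} ((e∈S , cS) , least) (e∈T , cT) =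
    ∣p∣≤∣p∩q∣⇒p⊆q S T (least (S ∩ T) (x∈p∩q⁺ (e∈S , e∈T) , ∩-closed cS cT))

  -- A closed set missing f has its complement in 𝒮_f.
  IsSe⇒⊆-closed : ∀ {f g S T} → IsSe G f S → g ∈ S → g ∈ T → Closed T → S ⊆ T
  IsSe⇒⊆-closed {f} {T = T} S-Se g∈S g∈T cT with f ∈? T
  ... | yes f∈T = IsSe⇒⊆ S-Se (f∈T , cT)
  ... | no f∉T  = contradiction g∈T (x∈∁p⇒x∉p (IsSe⇒⊆ S-Se (x∉p⇒x∈∁p f∉T , ∁-closed cT) g∈S))

  IsSe-disjoint : ∀ {e f S T d} → IsSe G e S → IsSe G f T → S ≢ T → d ∈ S → d ∉ T
  IsSe-disjoint S-Se T-Sf S≢T d∈S d∈T = S≢T (⊆-antisym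
    (IsSe⇒⊆-closed S-Se d∈S d∈T (proj₂ (proj₁ T-Sf)))
    (IsSe⇒⊆-closed T-Sf d∈T d∈S (proj₂ (proj₁ S-Se))))

  module Triangle (S : Subset (m G)) (a : Fin (n G)) where

    LinkedOutside : Fin (n G) → Set
    LinkedOutside v = ∃ λ r → r ∉ S × Joins G r a v

    linkedOutside? : ∀ v → Dec (LinkedOutside v)
    linkedOutside? v = any? (λ r → ¬? (r ∈? S) ×-dec joins? r a v)

    Spanned : Fin (m G) → Set
    Spanned d = LinkedOutside (proj₁ (ends G d)) × LinkedOutside (proj₂ (ends G d))

    spanned? : ∀ d → Dec (Spanned d)
    spanned? d = linkedOutside? (proj₁ (ends G d)) ×-dec linkedOutside? (proj₂ (ends G d))

    Joins⇒Spanned : ∀ {d u v} → Joins G d u v → LinkedOutside u → LinkedOutside v → Spanned d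
    Joins⇒Spanned (inj₁ refl) lu lv = lu , lv
    Joins⇒Spanned (inj₂ refl) lu lv = lv , lu

    Spanned⇒LinkedOutside : ∀ {d u v} → Joins G d u v → Spanned d → LinkedOutside u × LinkedOutside v
    Spanned⇒LinkedOutside (inj₁ refl) (lu , lv) = lu , lv
    Spanned⇒LinkedOutside (inj₂ refl) (lv , lu) = lu , lv

    Hull : Subset (m G)
    Hull = ∁ S ∪ fromDec spanned?

    -- If a = a₀ then r is parallel to d; if a ≁ a₀ then a-b-a₀ is an induced P₃
    -- from r ∉ S to d ∈ S; otherwise an edge t = aa₀ exists and lies outside S,
    -- as c-a-a₀ is an induced P₃ from r′ ∉ S to t.
    P3-end-linked : Closed S → ∀ {d a₀ b c} → d ∈ S → Joins G d a₀ b → a₀ ≢ c →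
                    ¬ Adj G a₀ c → LinkedOutside b → LinkedOutside c → LinkedOutside a₀
    P3-end-linked cS {d} {a₀} {b} {c} d∈S jd a₀≢c a₀≁c (r , r∉S , jr) (r′ , r′∉S , jr′)
      with a ≟ a₀ | adj? a a₀
    ... | yes refl | _ = contradiction (subst (_∈ S) (sym (noParallel G r d a b jr jd)) d∈S) r∉S
    ... | no a≢a₀ | no a≁a₀ = contradiction (a , b , a₀ , jr , Joins-sym jd , a≢a₀ , a≁a₀) (cS r d r∉S d∈S)
    ... | no _ | yes (t , jt) = t , t∉S , jt
      where
      t∉S : t ∉ S
      t∉S t∈S = cS r′ t r′∉S t∈S
        (c , a , a₀ , Joins-sym jr′ , jt , a₀≢c ∘ sym , a₀≁c ∘ Adj-sym)

    Hull-closed : Closed S → Closed Hull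
    Hull-closed cS d s d∉H s∈H p3@(a₀ , b , c , jd , js , a₀≢c , a₀≁c)
      with d ∈? S | x∈p∪q⁻ (∁ S) (fromDec spanned?) s∈H
    ... | no d∉S | _ = d∉H (x∈p∪q⁺ (inj₁ (x∉p⇒x∈∁p d∉S)))
    ... | yes d∈S | inj₁ s∈∁S = cS s d (x∈∁p⇒x∉p s∈∁S) d∈S (InducedP3-sym p3)
    ... | yes d∈S | inj₂ s∈Sp with Spanned⇒LinkedOutside js (∈-fromDec⁻ spanned? s∈Sp)
    ...   | lb , lc = d∉H (x∈p∪q⁺ (inj₂ (∈-fromDec⁺ spanned? d-spanned)))
      where
      d-spanned : Spanned d
      d-spanned = Joins⇒Spanned jd (P3-end-linked cS d∈S jd a₀≢c a₀≁c lb lc) lb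

    IsSe-apex∉V : ∀ {f g x y p q} → IsSe G f S → g ∈ S → Joins G g x y →
      Joins G p a x → p ∉ S → Joins G q a y → q ∉ S → ¬ (_∈V_ {G} a S)
    IsSe-apex∉V S-Se g∈S jg jp p∉S jq q∉S (d , d∈S , a∈d)
      with x∈p∪q⁻ (∁ S) (fromDec spanned?) (S⊆Hull d∈S)
      where
      S⊆Hull : S ⊆ Hull
      S⊆Hull = IsSe⇒⊆-closed S-Se g∈S
        (x∈p∪q⁺ (inj₂ (∈-fromDec⁺ spanned? (Joins⇒Spanned jg (_ , p∉S , jp) (_ , q∉S , jq)))))
        (Hull-closed (proj₂ (proj₁ S-Se)))
    ... | inj₁ d∈∁S = x∈∁p⇒x∉p d∈∁S d∈S
    ... | inj₂ d∈Sp with IsEnd⇒Joins a∈d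
    ...   | _ , jd with Spanned⇒LinkedOutside jd (∈-fromDec⁻ spanned? d∈Sp)
    ...     | (_ , _ , jloop) , _ = ¬Joins-loop jloop

  IsSe-corner : ∀ {e f A B x y w g} → IsSe G e A → IsSe G f B → (∀ {d} → d ∈ A → d ∉ B) →
    e ∈ A → Joins G e x y → g ∈ B → Joins G g x w → ¬ (_∈V_ {G} w A) ⊎ ¬ (_∈V_ {G} y B)
  IsSe-corner {A = A} {B} {x} {y} {w} {g} A-Se B-Sf A∩B=∅ e∈A je g∈B jg
    with w ≟ y | adj? w y
  ... | yes refl | _ = contradiction (subst (_∈ B) (noParallel G g _ x w jg je) g∈B) (A∩B=∅ e∈A)
  ... | no w≢y | no w≁y =
    contradiction (w , x , y , Joins-sym jg , je , w≢y , w≁y) (proj₂ (proj₁ A-Se) g _ g∉A e∈A)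
    where
    g∉A : g ∉ A
    g∉A g∈A = A∩B=∅ g∈A g∈B
  ... | no _ | yes (h , jh) with h ∈? A
  ...   | no h∉A = inj₁ (Triangle.IsSe-apex∉V A w A-Se e∈A je
                           (Joins-sym jg) (λ g∈A → A∩B=∅ g∈A g∈B) jh h∉A)
  ...   | yes h∈A = inj₂ (Triangle.IsSe-apex∉V B y B-Sf g∈B jg
                            (Joins-sym je) (A∩B=∅ e∈A) (Joins-sym jh) (A∩B=∅ h∈A))

lemma12 : (G : Graph) → Connected G → (e f : Fin (m G)) → (Se Sf : Subset (m G)) →
    IsSe G e Se → IsSe G f Sf → Se ≢ Sf → ¬ SameVertexSet G Se Sf
lemma12 G _ e f A B A-Se B-Sf A≢B same =
  let e∈A = proj₁ (proj₁ A-Se)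
      (g , g∈B , x∈g) = proj₁ (same _) (e , e∈A , inj₁ refl)
      (w , jg) = IsEnd⇒Joins G x∈g
  in [ (λ w∉VA → w∉VA (proj₂ (same w) (g , g∈B , Joins⇒IsEnd G (Joins-sym G jg))))
     , (λ y∉VB → y∉VB (proj₁ (same _) (e , e∈A , inj₂ refl)))
     ]′ (IsSe-corner G A-Se B-Sf (IsSe-disjoint G A-Se B-Sf A≢B) e∈A (inj₁ refl) g∈B jg)
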